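{- Let $A$ be an alphabet with $q\geq 2$ letters and $n\geq 1$. For $p\in\{1,2\}$ let $S_{n,p}=\sum_{w\in A^n}\mathrm{card}\{\pi : \pi \text{ a palindrome of length } p \text{ that is a factor of } w\}$. Then $$S_{n,1}=q^{n+1}-q(q-1)^n,$$ and $$S_{n,2}=q^{n+1}-\frac{q}{(q-1)\sqrt{q^2+2q-3}}\left(\left(\frac{q-1+\sqrt{q^2+2q-3}}{2}\right)^{n+2}-\left(\frac{q-1-\sqrt{q^2+2q-3}}{2}\right)^{n+2}\right).$$
   Context: $A^n$ is the set of words of length $n$ over $A$. A word is a palindrome if it equals its reversal; a factor is a block of consecutive letters of a word. In $S_{n,p}$ each palindrome is counted once per word in which it occurs (regardless of the number of occurrences in that word). -}

module Defs where

open import Data.Nat using (ℕ; zero; suc)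
open import Data.Fin using (Fin)
open import Data.Fin.Properties using () renaming (_≟_ to _≟ᶠ_)
open import Data.List using (List; []; _∷_; [_]; map; concatMap; reverse; filter; length; allFin)
open import Data.Nat.ListAction using (sum)
open import Data.List.Properties using (≡-dec)
open import Data.List.Relation.Binary.Infix.Heterogeneous using (Infix)
open import Data.List.Relation.Binary.Infix.Heterogeneous.Properties using (infix?)
open import Data.Product using (_×_; _,_)
open import Relation.Nullary using (Dec)
open import Relation.Nullary.Decidable using (_×-dec_)
open import Relation.Binary.PropositionalEquality using (_≡_)
open import Data.Rational as ℚ using (ℚ; _/_)
import Data.Integer as ℤ

words : (q n : ℕ) → List (List (Fin q))
words q zero    = [ [] ]
words q (suc n) = concatMap (λ a → map (a ∷_) (words q n)) (allFin q)

IsPalindrome : {q : ℕ} → List (Fin q) → Set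
IsPalindrome π = reverse π ≡ π

IsFactor : {q : ℕ} → List (Fin q) → List (Fin q) → Set
IsFactor π w = Infix _≡_ π w

palindrome? : {q : ℕ} (π : List (Fin q)) → Dec (IsPalindrome π)
palindrome? π = ≡-dec _≟ᶠ_ (reverse π) π

factor? : {q : ℕ} (π w : List (Fin q)) → Dec (IsFactor π w)
factor? π w = infix? _≟ᶠ_ π w

palFactorCount : {q : ℕ} → ℕ → List (Fin q) → ℕ
palFactorCount {q} p w =
  length (filter (λ π → palindrome? π ×-dec factor? π w) (words q p))

S : (q n p : ℕ) → ℕ
S q n p = sum (map (palFactorCount p) (words q n))

-- The quadratic field ℚ(√D): a + b√D represented as the pair (a , b).

infix 4 _+√_

record ℚ√ : Set where
  constructor _+√_
  field
    re : ℚ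
    im : ℚ

module _ (D : ℚ) where
  infixl 6 _⊕_ _⊖_
  infixl 7 _⊗_

  _⊕_ : ℚ√ → ℚ√ → ℚ√
  (a +√ b) ⊕ (c +√ d) = (a ℚ.+ c) +√ (b ℚ.+ d)

  _⊖_ : ℚ√ → ℚ√ → ℚ√
  (a +√ b) ⊖ (c +√ d) = (a ℚ.- c) +√ (b ℚ.- d)

  _⊗_ : ℚ√ → ℚ√ → ℚ√
  (a +√ b) ⊗ (c +√ d) = (a ℚ.* c ℚ.+ D ℚ.* (b ℚ.* d)) +√ (a ℚ.* d ℚ.+ b ℚ.* c)

  pow : ℚ√ → ℕ → ℚ√
  pow x zero    = ℚ.1ℚ +√ ℚ.0ℚ
  pow x (suc n) = x ⊗ pow x n

emb : ℚ → ℚ√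
emb a = a +√ ℚ.0ℚ

√D : ℚ√
√D = ℚ.0ℚ +√ ℚ.1ℚ

ℕ→ℚ : ℕ → ℚ
ℕ→ℚ n = ℤ.+ n / 1

Dq : ℕ → ℚ
Dq q = ℕ→ℚ (q Data.Nat.* q Data.Nat.+ 2 Data.Nat.* q) ℚ.- ℕ→ℚ 3
  where import Data.Nat

-- α = (q−1+√D)/2 and β = (q−1−√D)/2, with q−1 as a rational
α β : ℕ → ℚ√
α q = (ℕ→ℚ q ℚ.- ℚ.1ℚ) ℚ.* ℚ.½ +√ ℚ.½
β q = (ℕ→ℚ q ℚ.- ℚ.1ℚ) ℚ.* ℚ.½ +√ (ℚ.- ℚ.½)

module Submission where

-- The palindromes of length 1 are the letters a, those of length 2 the squares aa.
-- So S_{n,p} = Σ_a #{w ∈ A^n : π_a is a factor of w} with π_a = a resp. aa, and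
-- by complementary counting S_{n,p} = q·q^n − Σ_a #{w ∈ A^n avoiding π_a}.
-- Module Counting develops this: finite sums over letters and over words, the
-- complementary-counting principle, and the two avoidance counts, by the first
-- letter: (q−1)^n words avoid a letter, and E_n words avoid aa, where
-- E_0 = 1, E_1 = q, E_{n+2} = (q−1)(E_n + E_{n+1}).
-- Module ClosedForm works in ℚ(√D), D = q²+2q−3, where α, β = (q−1 ± √D)/2 are
-- the roots of x² = (q−1)x + (q−1). Conjugation shows α^k − β^k is a multiple
-- of √D; the coefficients t_k = (α^k − β^k)/√D obey the same recurrence as E,
-- so t_{k+2} = (q−1)E_k, which is the stated closed form for S_{n,2}.

open import Defs

module Counting where

  open import Data.Nat using (ℕ; zero; suc; _+_; _*_; _∸_; _^_)
  open import Data.Nat.Properties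
    using (+-0-commutativeMonoid; +-commutativeSemigroup; +-identityʳ; *-identityʳ; *-zeroʳ; *-assoc)
  open import Data.Nat.ListAction using (sum)
  open import Data.Nat.ListAction.Properties using (sum-++)
  open import Data.Fin using (Fin; zero; suc; punchIn)
  open import Data.Fin.Properties using (punchInᵢ≢i) renaming (_≟_ to _≟ᶠ_)
  open import Data.List using (List; []; _∷_; [_]; _++_; map; concatMap; filter; length; tabulate; allFin)
  open import Data.List.Properties using (map-cong; map-∘; map-++)
  open import Data.List.Relation.Binary.Infix.Heterogeneous using (here; there)
  open import Data.List.Relation.Binary.Prefix.Heterogeneous using (Prefix; _∷_; [])
  open import Data.Product using (_×_; _,_; proj₁; proj₂)
  open import Data.Empty using (⊥-elim)
  open import Function using (_∘_)
  open import Relation.Nullary using (Dec; yes; no; ¬_)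
  open import Relation.Nullary.Decidable using (_×-dec_)
  open import Relation.Unary using (Decidable)
  open import Relation.Binary.PropositionalEquality
    using (_≡_; _≢_; refl; sym; trans; cong; cong₂; module ≡-Reasoning)
  open import Algebra.Properties.CommutativeSemigroup +-commutativeSemigroup using (interchange)
  open import Algebra.Properties.CommutativeMonoid.Sum +-0-commutativeMonoid
    using (sum-syntax; sum-cong-≗; sum-remove; ∑-distrib-+)

  𝟙 : {P : Set} → Dec P → ℕ
  𝟙 (yes _) = 1
  𝟙 (no _)  = 0

  𝟙-yes : {P : Set} → P → (d : Dec P) → 𝟙 d ≡ 1
  𝟙-yes p (yes _) = refl
  𝟙-yes p (no ¬p) = ⊥-elim (¬p p)

  𝟙-no : {P : Set} → ¬ P → (d : Dec P) → 𝟙 d ≡ 0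
  𝟙-no ¬p (yes p) = ⊥-elim (¬p p)
  𝟙-no ¬p (no _)  = refl

  𝟙-⇔ : {P Q : Set} → (P → Q) → (Q → P) → (d : Dec P) (e : Dec Q) → 𝟙 d ≡ 𝟙 e
  𝟙-⇔ f g (yes p) e = sym (𝟙-yes (f p) e)
  𝟙-⇔ f g (no ¬p) e = sym (𝟙-no (¬p ∘ g) e)

  length-filter : {A : Set} {P : A → Set} (P? : Decidable P) (xs : List A) →
    length (filter P? xs) ≡ sum (map (𝟙 ∘ P?) xs)
  length-filter P? [] = refl
  length-filter P? (x ∷ xs) with P? x
  ... | yes _ = cong suc (length-filter P? xs)
  ... | no _  = length-filter P? xs

  ∑-cong : ∀ q {f g : Fin q → ℕ} → (∀ a → f a ≡ g a) → ∑[ a < q ] f a ≡ ∑[ a < q ] g a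
  ∑-cong q = sum-cong-≗

  ∑-const : ∀ n x → ∑[ _ < n ] x ≡ n * x
  ∑-const zero    x = refl
  ∑-const (suc n) x = cong (x +_) (∑-const n x)

  ∑-constant-off : ∀ {q} (a : Fin q) (f : Fin q → ℕ) {y : ℕ} →
    (∀ b → b ≢ a → f b ≡ y) → ∑[ b < q ] f b ≡ f a + (q ∸ 1) * y
  ∑-constant-off {suc m} a f {y} off =
    trans (sum-remove {i = a} f)
          (cong (f a +_) (trans (∑-cong m (λ j → off (punchIn a j) (punchInᵢ≢i a j)))
                                (∑-const m y)))

  sum-map-+ : {A : Set} (f g : A → ℕ) (xs : List A) →
    sum (map (λ x → f x + g x) xs) ≡ sum (map f xs) + sum (map g xs)
  sum-map-+ f g [] = refl
  sum-map-+ f g (x ∷ xs) =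
    trans (cong (f x + g x +_) (sum-map-+ f g xs)) (interchange (f x) (g x) _ _)

  sum-map-∑ : {A : Set} (q : ℕ) (h : Fin q → A → ℕ) (xs : List A) →
    sum (map (λ x → ∑[ a < q ] h a x) xs) ≡ ∑[ a < q ] sum (map (h a) xs)
  sum-map-∑ q h [] = sym (trans (∑-const q 0) (*-zeroʳ q))
  sum-map-∑ q h (x ∷ xs) =
    trans (cong (∑[ a < q ] h a x +_) (sum-map-∑ q h xs))
          (sym (∑-distrib-+ {q} (λ a → h a x) (λ a → sum (map (h a) xs))))

  sum-concatMap : {A B : Set} (g : B → ℕ) (f : A → List B) (xs : List A) →
    sum (map g (concatMap f xs)) ≡ sum (map (λ x → sum (map g (f x))) xs)
  sum-concatMap g f [] = refl
  sum-concatMap g f (x ∷ xs) = begin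
    sum (map g (f x ++ concatMap f xs))
      ≡⟨ cong sum (map-++ g (f x) _) ⟩
    sum (map g (f x) ++ map g (concatMap f xs))
      ≡⟨ sum-++ (map g (f x)) _ ⟩
    sum (map g (f x)) + sum (map g (concatMap f xs))
      ≡⟨ cong (sum (map g (f x)) +_) (sum-concatMap g f xs) ⟩
    sum (map (λ x → sum (map g (f x))) (x ∷ xs)) ∎
    where open ≡-Reasoning

  sum-map-tabulate : {A : Set} (q : ℕ) (h : Fin q → A) (f : A → ℕ) →
    sum (map f (tabulate h)) ≡ ∑[ i < q ] f (h i)
  sum-map-tabulate zero    h f = refl
  sum-map-tabulate (suc q) h f = cong (f (h zero) +_) (sum-map-tabulate q (h ∘ suc) f)

  wordSum : (q n : ℕ) → (List (Fin q) → ℕ) → ℕ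
  wordSum q n g = sum (map g (words q n))

  wordSum-cong : ∀ q n {f g : List (Fin q) → ℕ} → (∀ w → f w ≡ g w) →
    wordSum q n f ≡ wordSum q n g
  wordSum-cong q n f≗g = cong sum (map-cong f≗g (words q n))

  wordSum-suc : ∀ q n (g : List (Fin q) → ℕ) →
    wordSum q (suc n) g ≡ ∑[ a < q ] wordSum q n (λ w → g (a ∷ w))
  wordSum-suc q n g = begin
    sum (map g (concatMap (λ a → map (a ∷_) (words q n)) (allFin q)))
      ≡⟨ sum-concatMap g _ (allFin q) ⟩
    sum (map (λ a → sum (map g (map (a ∷_) (words q n)))) (allFin q))
      ≡⟨ sum-map-tabulate q (λ a → a) _ ⟩
    ∑[ a < q ] sum (map g (map (a ∷_) (words q n)))
      ≡⟨ ∑-cong q (λ a → cong sum (sym (map-∘ (words q n)))) ⟩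
    ∑[ a < q ] wordSum q n (λ w → g (a ∷ w)) ∎
    where open ≡-Reasoning

  wordSum-1 : ∀ q (g : List (Fin q) → ℕ) → wordSum q 1 g ≡ ∑[ a < q ] g [ a ]
  wordSum-1 q g = trans (wordSum-suc q 0 g) (∑-cong q (λ a → +-identityʳ (g [ a ])))

  wordSum-const : ∀ q n k → wordSum q n (λ _ → k) ≡ q ^ n * k
  wordSum-const q zero    k = refl
  wordSum-const q (suc n) k = begin
    wordSum q (suc n) (λ _ → k)  ≡⟨ wordSum-suc q n _ ⟩
    ∑[ _ < q ] wordSum q n (λ _ → k) ≡⟨ ∑-cong q (λ _ → wordSum-const q n k) ⟩
    ∑[ _ < q ] (q ^ n * k)       ≡⟨ ∑-const q (q ^ n * k) ⟩
    q * (q ^ n * k)              ≡⟨ *-assoc q (q ^ n) k ⟨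
    q ^ suc n * k                ∎
    where open ≡-Reasoning

  wordSum-zero : ∀ q n {g : List (Fin q) → ℕ} → (∀ w → g w ≡ 0) → wordSum q n g ≡ 0
  wordSum-zero q n g≗0 =
    trans (wordSum-cong q n g≗0) (trans (wordSum-const q n 0) (*-zeroʳ (q ^ n)))

  complement-count : ∀ q n (H K : Fin q → List (Fin q) → ℕ) (k : ℕ) →
    (∀ a w → H a w + K a w ≡ 1) → (∀ a → wordSum q n (K a) ≡ k) →
    wordSum q n (λ w → ∑[ a < q ] H a w) + q * k ≡ q * q ^ n
  complement-count q n H K k complementary K-total = begin
    wordSum q n (λ w → ∑[ a < q ] H a w) + q * k
      ≡⟨ cong₂ _+_ (sum-map-∑ q H (words q n)) (sym (∑-const q k)) ⟩
    ∑[ a < q ] wordSum q n (H a) + ∑[ a < q ] k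
      ≡⟨ cong (∑[ a < q ] wordSum q n (H a) +_) (∑-cong q (λ a → sym (K-total a))) ⟩
    ∑[ a < q ] wordSum q n (H a) + ∑[ a < q ] wordSum q n (K a)
      ≡⟨ ∑-distrib-+ {q} (λ a → wordSum q n (H a)) (λ a → wordSum q n (K a)) ⟨
    ∑[ a < q ] (wordSum q n (H a) + wordSum q n (K a))
      ≡⟨ ∑-cong q (λ a → sum-map-+ (H a) (K a) (words q n)) ⟨
    ∑[ a < q ] wordSum q n (λ w → H a w + K a w)
      ≡⟨ ∑-cong q (λ a → wordSum-cong q n (complementary a)) ⟩
    ∑[ a < q ] wordSum q n (λ _ → 1)
      ≡⟨ ∑-cong q (λ _ → trans (wordSum-const q n 1) (*-identityʳ (q ^ n))) ⟩
    ∑[ a < q ] (q ^ n)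
      ≡⟨ ∑-const q (q ^ n) ⟩
    q * q ^ n ∎
    where open ≡-Reasoning

  palFactorCount-as-sum : ∀ {q} p (w : List (Fin q)) →
    palFactorCount p w ≡ wordSum q p (λ π → 𝟙 (palindrome? π ×-dec factor? π w))
  palFactorCount-as-sum {q} p w = length-filter _ (words q p)

  -- Every word of length one is a palindrome.
  palFactorCount-1 : ∀ {q} (w : List (Fin q)) →
    palFactorCount 1 w ≡ ∑[ a < q ] 𝟙 (factor? [ a ] w)
  palFactorCount-1 {q} w =
    trans (palFactorCount-as-sum 1 w)
          (trans (wordSum-1 q _) (∑-cong q (λ a → 𝟙-⇔ proj₂ (refl ,_) _ _)))

  -- The palindromes of length two are the squares aa.
  palFactorCount-2 : ∀ {q} (w : List (Fin q)) →
    palFactorCount 2 w ≡ ∑[ a < q ] 𝟙 (factor? (a ∷ a ∷ []) w)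
  palFactorCount-2 {q} w = begin
    palFactorCount 2 w
      ≡⟨ trans (palFactorCount-as-sum 2 w) (wordSum-suc q 1 _) ⟩
    ∑[ a < q ] wordSum q 1 (λ π → 𝟙 (palindrome? (a ∷ π) ×-dec factor? (a ∷ π) w))
      ≡⟨ ∑-cong q (λ a → wordSum-1 q _) ⟩
    ∑[ a < q ] ∑[ b < q ] 𝟙 (palindrome? (a ∷ b ∷ []) ×-dec factor? (a ∷ b ∷ []) w)
      ≡⟨ ∑-cong q (λ a → ∑-constant-off a _ (λ b b≢a → 𝟙-no (b≢a ∘ second-letter ∘ proj₁) _)) ⟩
    ∑[ a < q ] (𝟙 (palindrome? (a ∷ a ∷ []) ×-dec factor? (a ∷ a ∷ []) w) + (q ∸ 1) * 0)
      ≡⟨ ∑-cong q (λ a → cong₂ _+_ (𝟙-⇔ proj₂ (refl ,_) _ _) (*-zeroʳ (q ∸ 1))) ⟩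
    ∑[ a < q ] (𝟙 (factor? (a ∷ a ∷ []) w) + 0)
      ≡⟨ ∑-cong q (λ a → +-identityʳ _) ⟩
    ∑[ a < q ] 𝟙 (factor? (a ∷ a ∷ []) w) ∎
    where
    open ≡-Reasoning
    second-letter : ∀ {a b : Fin q} → IsPalindrome (a ∷ b ∷ []) → b ≡ a
    second-letter refl = refl

  unless : {P : Set} → Dec P → ℕ → ℕ
  unless (yes _) r = 0
  unless (no _)  r = r

  unless-yes : {P : Set} {r : ℕ} → P → (d : Dec P) → unless d r ≡ 0
  unless-yes p (yes _) = refl
  unless-yes p (no ¬p) = ⊥-elim (¬p p)

  unless-no : {P : Set} {r : ℕ} → ¬ P → (d : Dec P) → unless d r ≡ r
  unless-no ¬p (yes p) = ⊥-elim (¬p p)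
  unless-no ¬p (no _)  = refl

  𝟙-factor-tail : ∀ {q} {π w : List (Fin q)} {b : Fin q} → ¬ Prefix _≡_ π (b ∷ w) →
    𝟙 (factor? π (b ∷ w)) ≡ 𝟙 (factor? π w)
  𝟙-factor-tail ¬prefix =
    𝟙-⇔ (λ { (here p) → ⊥-elim (¬prefix p) ; (there i) → i }) there _ _

  -- squareFreeCount c n: the number of words of length n over an alphabet of
  -- c + 1 letters that do not contain the square aa of a fixed letter a.
  squareFreeCount : ℕ → ℕ → ℕ
  squareFreeCount c zero          = 1
  squareFreeCount c (suc zero)    = suc c
  squareFreeCount c (suc (suc n)) = c * squareFreeCount c n + c * squareFreeCount c (suc n)

  module Avoidance {q : ℕ} where

    avoidsLetter : Fin q → List (Fin q) → ℕ
    avoidsLetter a []      = 1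
    avoidsLetter a (b ∷ w) = unless (b ≟ᶠ a) (avoidsLetter a w)

    avoidsSquare : Fin q → List (Fin q) → ℕ
    avoidsSquare a []          = 1
    avoidsSquare a (b ∷ [])    = 1
    avoidsSquare a (b ∷ c ∷ w) = unless (b ≟ᶠ a ×-dec c ≟ᶠ a) (avoidsSquare a (c ∷ w))

    letter-complement : ∀ a w → 𝟙 (factor? [ a ] w) + avoidsLetter a w ≡ 1
    letter-complement a [] = cong (_+ 1) (𝟙-no (λ { (here ()) }) (factor? [ a ] []))
    letter-complement a (b ∷ w) with b ≟ᶠ a
    ... | yes b≡a = cong (_+ 0) (𝟙-yes (here (sym b≡a ∷ [])) (factor? [ a ] (b ∷ w)))
    ... | no b≢a  = trans (cong (_+ avoidsLetter a w) (𝟙-factor-tail λ { (a≡b ∷ _) → b≢a (sym a≡b) }))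
                          (letter-complement a w)

    square-complement : ∀ a w → 𝟙 (factor? (a ∷ a ∷ []) w) + avoidsSquare a w ≡ 1
    square-complement a [] =
      cong (_+ 1) (𝟙-no (λ { (here ()) }) (factor? (a ∷ a ∷ []) []))
    square-complement a (b ∷ []) =
      cong (_+ 1) (𝟙-no (λ { (here (_ ∷ ())) ; (there (here ())) }) (factor? (a ∷ a ∷ []) (b ∷ [])))
    square-complement a (b ∷ c ∷ w) =
      extend (b ≟ᶠ a ×-dec c ≟ᶠ a) (square-complement a (c ∷ w))
      where
      extend : (d : Dec (b ≡ a × c ≡ a)) →
        𝟙 (factor? (a ∷ a ∷ []) (c ∷ w)) + avoidsSquare a (c ∷ w) ≡ 1 →
        𝟙 (factor? (a ∷ a ∷ []) (b ∷ c ∷ w)) + unless d (avoidsSquare a (c ∷ w)) ≡ 1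
      extend (yes (b≡a , c≡a)) _ =
        cong (_+ 0) (𝟙-yes (here (sym b≡a ∷ sym c≡a ∷ [])) (factor? (a ∷ a ∷ []) (b ∷ c ∷ w)))
      extend (no ¬bc) ih =
        trans (cong (_+ avoidsSquare a (c ∷ w))
                    (𝟙-factor-tail λ { (a≡b ∷ a≡c ∷ _) → ¬bc (sym a≡b , sym a≡c) }))
              ih

    -- There are (q−1)^n words of length n avoiding a: by the first letter,
    -- words starting with a contribute nothing, each other first letter the count for n.
    avoidsLetter-count : ∀ n a → wordSum q n (avoidsLetter a) ≡ (q ∸ 1) ^ n
    avoidsLetter-count zero    a = refl
    avoidsLetter-count (suc n) a = begin
      wordSum q (suc n) (avoidsLetter a)
        ≡⟨ wordSum-suc q n (avoidsLetter a) ⟩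
      ∑[ b < q ] wordSum q n (λ w → unless (b ≟ᶠ a) (avoidsLetter a w))
        ≡⟨ ∑-constant-off a _ (λ b b≢a →
             trans (wordSum-cong q n (λ w → unless-no b≢a (b ≟ᶠ a))) (avoidsLetter-count n a)) ⟩
      wordSum q n (λ w → unless (a ≟ᶠ a) (avoidsLetter a w)) + (q ∸ 1) * (q ∸ 1) ^ n
        ≡⟨ cong (_+ (q ∸ 1) ^ suc n) (wordSum-zero q n (λ w → unless-yes refl (a ≟ᶠ a))) ⟩
      (q ∸ 1) ^ suc n ∎
      where open ≡-Reasoning

    avoidsSquare-other : ∀ {a b} w → b ≢ a → avoidsSquare a (b ∷ w) ≡ avoidsSquare a w
    avoidsSquare-other []      b≢a = refl
    avoidsSquare-other (c ∷ w) b≢a = unless-no (b≢a ∘ proj₁) _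

    avoidsSquare-suc : ∀ n a →
      wordSum q (suc n) (avoidsSquare a)
        ≡ wordSum q n (λ w → avoidsSquare a (a ∷ w)) + (q ∸ 1) * wordSum q n (avoidsSquare a)
    avoidsSquare-suc n a =
      trans (wordSum-suc q n (avoidsSquare a))
            (∑-constant-off a _ (λ b b≢a → wordSum-cong q n (λ w → avoidsSquare-other w b≢a)))

    -- An aa-avoiding word starting with a continues with a letter other than a.
    avoidsSquare-after-a : ∀ n a →
      wordSum q (suc n) (λ w → avoidsSquare a (a ∷ w)) ≡ (q ∸ 1) * wordSum q n (avoidsSquare a)
    avoidsSquare-after-a n a = begin
      wordSum q (suc n) (λ w → avoidsSquare a (a ∷ w))
        ≡⟨ wordSum-suc q n (λ w → avoidsSquare a (a ∷ w)) ⟩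
      ∑[ b < q ] wordSum q n (λ w → avoidsSquare a (a ∷ b ∷ w))
        ≡⟨ ∑-constant-off a _ (λ b b≢a → wordSum-cong q n (λ w → a-then-other w b≢a)) ⟩
      wordSum q n (λ w → avoidsSquare a (a ∷ a ∷ w)) + (q ∸ 1) * wordSum q n (avoidsSquare a)
        ≡⟨ cong (_+ (q ∸ 1) * wordSum q n (avoidsSquare a)) (wordSum-zero q n a-then-a) ⟩
      (q ∸ 1) * wordSum q n (avoidsSquare a) ∎
      where
      open ≡-Reasoning
      a-then-a : ∀ w → avoidsSquare a (a ∷ a ∷ w) ≡ 0
      a-then-a w = unless-yes (refl , refl) (a ≟ᶠ a ×-dec a ≟ᶠ a)
      a-then-other : ∀ {b} w → b ≢ a → avoidsSquare a (a ∷ b ∷ w) ≡ avoidsSquare a w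
      a-then-other {b} w b≢a =
        trans (unless-no (b≢a ∘ proj₂) (a ≟ᶠ a ×-dec b ≟ᶠ a)) (avoidsSquare-other w b≢a)

    avoidsSquare-count : ∀ n a → wordSum q n (avoidsSquare a) ≡ squareFreeCount (q ∸ 1) n
    avoidsSquare-count zero          a = refl
    avoidsSquare-count (suc zero)    a = trans (avoidsSquare-suc 0 a) (cong suc (*-identityʳ (q ∸ 1)))
    avoidsSquare-count (suc (suc n)) a = begin
      wordSum q (suc (suc n)) (avoidsSquare a)
        ≡⟨ avoidsSquare-suc (suc n) a ⟩
      wordSum q (suc n) (λ w → avoidsSquare a (a ∷ w)) + c * wordSum q (suc n) (avoidsSquare a)
        ≡⟨ cong (_+ c * wordSum q (suc n) (avoidsSquare a)) (avoidsSquare-after-a n a) ⟩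
      c * wordSum q n (avoidsSquare a) + c * wordSum q (suc n) (avoidsSquare a)
        ≡⟨ cong₂ (λ x y → c * x + c * y) (avoidsSquare-count n a) (avoidsSquare-count (suc n) a) ⟩
      squareFreeCount c (suc (suc n)) ∎
      where
      open ≡-Reasoning
      c : ℕ
      c = q ∸ 1

  open Avoidance

  -- S_{n,1} + q(q−1)^n = q^(n+1): a letter fails to occur in exactly (q−1)^n words.
  S₁-complement : ∀ q n → S q n 1 + q * (q ∸ 1) ^ n ≡ q * q ^ n
  S₁-complement q n =
    trans (cong (_+ q * (q ∸ 1) ^ n) (wordSum-cong q n palFactorCount-1))
          (complement-count q n (λ a w → 𝟙 (factor? [ a ] w)) avoidsLetter ((q ∸ 1) ^ n)
                            letter-complement (avoidsLetter-count n))

  S₂-complement : ∀ q n → S q n 2 + q * squareFreeCount (q ∸ 1) n ≡ q * q ^ n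
  S₂-complement q n =
    trans (cong (_+ q * squareFreeCount (q ∸ 1) n) (wordSum-cong q n palFactorCount-2))
          (complement-count q n (λ a w → 𝟙 (factor? (a ∷ a ∷ []) w)) avoidsSquare
                            (squareFreeCount (q ∸ 1) n) square-complement (avoidsSquare-count n))

module ClosedForm where

  open import Data.Nat using (ℕ; zero; suc)
  import Data.Nat as ℕ
  import Data.Integer as ℤ
  import Data.Integer.Properties as ℤP
  open import Data.Rational using (ℚ; mkℚ; _/_; 0ℚ; 1ℚ; ½; _+_; _*_; _-_; -_)
  open import Data.Rational.Properties using (normalize-coprime)
  open import Data.Nat.Coprimality using (1-coprimeTo) renaming (sym to coprime-sym)
  open import Data.Product using (_×_; _,_; proj₁)
  open import Relation.Binary.PropositionalEquality
    using (_≡_; refl; sym; trans; cong; cong₂; module ≡-Reasoning)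
  open import Data.Rational.Solver using (module +-*-Solver)
  open +-*-Solver using (solve; _:+_; _:*_; :-_; _:-_; _:=_; con)

  ℕ→ℚ-mkℚ : ∀ n → ℕ→ℚ n ≡ mkℚ (ℤ.+ n) 0 (coprime-sym (1-coprimeTo n))
  ℕ→ℚ-mkℚ n = normalize-coprime (coprime-sym (1-coprimeTo n))

  ℕ→ℚ-+ : ∀ m n → ℕ→ℚ (m ℕ.+ n) ≡ ℕ→ℚ m + ℕ→ℚ n
  ℕ→ℚ-+ m n = trans (cong (_/ 1) numerators) (sym (cong₂ _+_ (ℕ→ℚ-mkℚ m) (ℕ→ℚ-mkℚ n)))
    where
    numerators : ℤ.+ (m ℕ.+ n) ≡ ℤ.+ m ℤ.* ℤ.+ 1 ℤ.+ ℤ.+ n ℤ.* ℤ.+ 1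
    numerators = trans (ℤP.pos-+ m n)
      (sym (cong₂ ℤ._+_ (ℤP.*-identityʳ (ℤ.+ m)) (ℤP.*-identityʳ (ℤ.+ n))))

  ℕ→ℚ-* : ∀ m n → ℕ→ℚ (m ℕ.* n) ≡ ℕ→ℚ m * ℕ→ℚ n
  ℕ→ℚ-* m n = trans (cong (_/ 1) (ℤP.pos-* m n)) (sym (cong₂ _*_ (ℕ→ℚ-mkℚ m) (ℕ→ℚ-mkℚ n)))

  ℕ→ℚ-∸ : ∀ m k {t} → m ℕ.+ k ≡ t → ℕ→ℚ t - ℕ→ℚ m ≡ ℕ→ℚ k
  ℕ→ℚ-∸ m k refl =
    trans (cong (_- ℕ→ℚ m) (ℕ→ℚ-+ m k))
          (solve 2 (λ x y → (x :+ y) :- x := y) refl (ℕ→ℚ m) (ℕ→ℚ k))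

  module QuadraticField (D : ℚ) where
    open ℚ√

    infixl 6 _⊝_
    infixl 7 _·_

    _·_ _⊝_ : ℚ√ → ℚ√ → ℚ√
    _·_ = _⊗_ D
    _⊝_ = _⊖_ D

    conj : ℚ√ → ℚ√
    conj (a +√ b) = a +√ (- b)

    conj-· : ∀ x y → conj (x · y) ≡ conj x · conj y
    conj-· (a +√ b) (c +√ d) = cong₂ _+√_
      (solve 5 (λ D a b c d → a :* c :+ D :* (b :* d) := a :* c :+ D :* ((:- b) :* (:- d))) refl D a b c d)
      (solve 4 (λ a b c d → :- (a :* d :+ b :* c) := a :* (:- d) :+ (:- b) :* c) refl a b c d)

    conj-pow : ∀ x k → conj (pow D x k) ≡ pow D (conj x) k
    conj-pow x zero    = refl
    conj-pow x (suc k) = trans (conj-· x (pow D x k)) (cong (conj x ·_) (conj-pow x k))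

    -- x² = tr(x)·x − N(x), so the √D-coordinates of the powers of x satisfy
    -- a second-order linear recurrence with coefficients the trace and the norm.
    trace norm : ℚ√ → ℚ
    trace x = re x + re x
    norm x = re x * re x - D * (im x * im x)

    im-pow-recurrence : ∀ x k →
      im (pow D x (suc (suc k))) ≡ trace x * im (pow D x (suc k)) - norm x * im (pow D x k)
    im-pow-recurrence (a +√ b) k =
      solve 5 (λ D a b r s → a :* (a :* s :+ b :* r) :+ b :* (a :* r :+ D :* (b :* s))
                           := (a :+ a) :* (a :* s :+ b :* r) :- (a :* a :- D :* (b :* b)) :* s)
              refl D a b (re (pow D (a +√ b) k)) (im (pow D (a +√ b) k))

    emb·[emb·√D] : ∀ x y → emb x · (emb y · √D) ≡ (0ℚ +√ x * y)
    emb·[emb·√D] x y = cong₂ _+√_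
      (solve 3 (λ D x y → x :* (y :* con 0ℚ :+ D :* (con 0ℚ :* con 1ℚ))
                            :+ D :* (con 0ℚ :* (y :* con 1ℚ :+ con 0ℚ :* con 0ℚ)) := con 0ℚ)
               refl D x y)
      (solve 3 (λ D x y → x :* (y :* con 1ℚ :+ con 0ℚ :* con 0ℚ)
                            :+ con 0ℚ :* (y :* con 0ℚ :+ D :* (con 0ℚ :* con 1ℚ)) := x :* y)
               refl D x y)

    emb·[u⊝conj-u] : ∀ x u → emb x · (u ⊝ conj u) ≡ (0ℚ +√ x * (im u + im u))
    emb·[u⊝conj-u] x (a +√ b) = cong₂ _+√_
      (solve 4 (λ D x a b → x :* (a :- a) :+ D :* (con 0ℚ :* (b :- (:- b))) := con 0ℚ) refl D x a b)
      (solve 3 (λ x a b → x :* (b :- (:- b)) :+ con 0ℚ :* (a :- a) := x :* (b :+ b)) refl x a b)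

  recurrence-unique : {A : Set} (step : A → A → A) (u v : ℕ → A) →
    (∀ k → u (suc (suc k)) ≡ step (u (suc k)) (u k)) →
    (∀ k → v (suc (suc k)) ≡ step (v (suc k)) (v k)) →
    u 0 ≡ v 0 → u 1 ≡ v 1 → ∀ k → u k ≡ v k
  recurrence-unique step u v u-rec v-rec u₀≡v₀ u₁≡v₁ k = proj₁ (agree k)
    where
    agree : ∀ k → u k ≡ v k × u (suc k) ≡ v (suc k)
    agree zero    = u₀≡v₀ , u₁≡v₁
    agree (suc k) with agree k
    ... | uₖ≡vₖ , uₖ₊₁≡vₖ₊₁ =
      uₖ₊₁≡vₖ₊₁ , trans (u-rec k) (trans (cong₂ step uₖ₊₁≡vₖ₊₁ uₖ≡vₖ) (sym (v-rec k)))

  module SquarePalindromes (c : ℕ) where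
    open ℚ√
    open Counting using (squareFreeCount)

    q : ℕ
    q = suc c

    C : ℚ
    C = ℕ→ℚ c

    open QuadraticField (Dq q)

    q-1≡C : ℕ→ℚ q - 1ℚ ≡ C
    q-1≡C = trans (cong (_- 1ℚ) (ℕ→ℚ-+ 1 c)) (solve 1 (λ x → (con 1ℚ :+ x) :- con 1ℚ := x) refl C)

    discriminant : Dq q ≡ C * C + ℕ→ℚ 4 * C
    discriminant = begin
      ℕ→ℚ (q ℕ.* q ℕ.+ 2 ℕ.* q) - ℕ→ℚ 3
        ≡⟨ cong (_- ℕ→ℚ 3) (trans (ℕ→ℚ-+ (q ℕ.* q) (2 ℕ.* q)) (cong₂ _+_ (ℕ→ℚ-* q q) (ℕ→ℚ-* 2 q))) ⟩
      ℕ→ℚ q * ℕ→ℚ q + ℕ→ℚ 2 * ℕ→ℚ q - ℕ→ℚ 3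
        ≡⟨ cong (λ x → x * x + ℕ→ℚ 2 * x - ℕ→ℚ 3) (ℕ→ℚ-+ 1 c) ⟩
      (1ℚ + C) * (1ℚ + C) + ℕ→ℚ 2 * (1ℚ + C) - ℕ→ℚ 3
        ≡⟨ solve 1 (λ x → (con 1ℚ :+ x) :* (con 1ℚ :+ x) :+ con (ℕ→ℚ 2) :* (con 1ℚ :+ x) :- con (ℕ→ℚ 3)
                           := x :* x :+ con (ℕ→ℚ 4) :* x) refl C ⟩
      C * C + ℕ→ℚ 4 * C ∎
      where open ≡-Reasoning

    -- α has trace q − 1 and norm −(q − 1): it is a root of x² = (q−1)x + (q−1).
    trace-α : trace (α q) ≡ C
    trace-α = trans (cong (λ x → x * ½ + x * ½) q-1≡C)
                    (solve 1 (λ x → x :* con ½ :+ x :* con ½ := x) refl C)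

    norm-α : norm (α q) ≡ - C
    norm-α = trans (cong₂ (λ x D → x * ½ * (x * ½) - D * (½ * ½)) q-1≡C discriminant)
      (solve 1 (λ x → x :* con ½ :* (x :* con ½) :- (x :* x :+ con (ℕ→ℚ 4) :* x) :* (con ½ :* con ½)
                      := :- x) refl C)

    -- s k is the √D-coordinate of α^k, so t k = 2 s k = (α^k − β^k)/√D.
    s t : ℕ → ℚ
    s k = im (pow (Dq q) (α q) k)
    t k = s k + s k

    t₁ : t 1 ≡ 1ℚ
    t₁ = solve 1 (λ a → (a :* con 0ℚ :+ con ½ :* con 1ℚ) :+ (a :* con 0ℚ :+ con ½ :* con 1ℚ) := con 1ℚ)
           refl (re (α q))

    t-recurrence : ∀ k → t (suc (suc k)) ≡ C * t (suc k) + C * t k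
    t-recurrence k = begin
      s (suc (suc k)) + s (suc (suc k))
        ≡⟨ cong (λ x → x + x) (trans (im-pow-recurrence (α q) k)
                                     (cong₂ (λ T N → T * s (suc k) - N * s k) trace-α norm-α)) ⟩
      (C * s (suc k) - (- C) * s k) + (C * s (suc k) - (- C) * s k)
        ≡⟨ solve 3 (λ C x y → (C :* x :- (:- C) :* y) :+ (C :* x :- (:- C) :* y)
                              := C :* (x :+ x) :+ C :* (y :+ y)) refl C (s (suc k)) (s k) ⟩
      C * t (suc k) + C * t k ∎
      where open ≡-Reasoning

    e : ℕ → ℚ
    e k = ℕ→ℚ (squareFreeCount c k)

    e-recurrence : ∀ k → e (suc (suc k)) ≡ C * e k + C * e (suc k)
    e-recurrence k =
      trans (ℕ→ℚ-+ (c ℕ.* squareFreeCount c k) (c ℕ.* squareFreeCount c (suc k)))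
            (cong₂ _+_ (ℕ→ℚ-* c (squareFreeCount c k)) (ℕ→ℚ-* c (squareFreeCount c (suc k))))

    t≡C*e : ∀ k → t (suc (suc k)) ≡ C * e k
    t≡C*e = recurrence-unique (λ x y → C * x + C * y) (λ k → t (suc (suc k))) (λ k → C * e k)
      (λ k → t-recurrence (suc (suc k)))
      (λ k → trans (cong (C *_) (e-recurrence k))
                   (solve 3 (λ C x y → C :* (C :* x :+ C :* y) := C :* (C :* y) :+ C :* (C :* x))
                          refl C (e k) (e (suc k))))
      t₂ t₃
      where
      t₂ : t 2 ≡ C * 1ℚ
      t₂ = trans (t-recurrence 0)
             (trans (cong (λ x → C * x + C * (0ℚ + 0ℚ)) t₁)
                    (solve 1 (λ C → C :* con 1ℚ :+ C :* (con 0ℚ :+ con 0ℚ) := C :* con 1ℚ) refl C))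
      t₃ : t 3 ≡ C * ℕ→ℚ (suc c)
      t₃ = trans (t-recurrence 1)
             (trans (cong₂ (λ x y → C * x + C * y) t₂ t₁)
               (trans (solve 1 (λ C → C :* (C :* con 1ℚ) :+ C :* con 1ℚ := C :* (con 1ℚ :+ C)) refl C)
                      (cong (C *_) (sym (ℕ→ℚ-+ 1 c)))))

    -- The closed form for any Sv with Sv + q·E_n = q^(n+1), as S_{n,2} satisfies:
    -- (q^(n+1) − Sv)(q−1)√D = q(q−1)E_n√D = q·t_{n+2}√D = q(α^(n+2) − β^(n+2)).
    closed-form : ∀ n Sv → Sv ℕ.+ q ℕ.* squareFreeCount c n ≡ q ℕ.* q ℕ.^ n →
      emb (ℕ→ℚ (q ℕ.^ suc n) - ℕ→ℚ Sv) · (emb (ℕ→ℚ q - 1ℚ) · √D)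
        ≡ emb (ℕ→ℚ q) · (pow (Dq q) (α q) (suc (suc n)) ⊝ pow (Dq q) (β q) (suc (suc n)))
    closed-form n Sv total = begin
      emb X · (emb (Q - 1ℚ) · √D)
        ≡⟨ emb·[emb·√D] X (Q - 1ℚ) ⟩
      (0ℚ +√ X * (Q - 1ℚ))
        ≡⟨ cong (0ℚ +√_) X*[Q-1]≡Q*t ⟩
      (0ℚ +√ Q * t (suc (suc n)))
        ≡⟨ emb·[u⊝conj-u] Q (pow (Dq q) (α q) (suc (suc n))) ⟨
      emb Q · (pow (Dq q) (α q) (suc (suc n)) ⊝ conj (pow (Dq q) (α q) (suc (suc n))))
        ≡⟨ cong (λ z → emb Q · (pow (Dq q) (α q) (suc (suc n)) ⊝ z)) (conj-pow (α q) (suc (suc n))) ⟩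
      emb Q · (pow (Dq q) (α q) (suc (suc n)) ⊝ pow (Dq q) (β q) (suc (suc n))) ∎
      where
      open ≡-Reasoning
      Q X : ℚ
      Q = ℕ→ℚ q
      X = ℕ→ℚ (q ℕ.^ suc n) - ℕ→ℚ Sv
      X≡Q*e : X ≡ Q * e n
      X≡Q*e = trans (ℕ→ℚ-∸ Sv (q ℕ.* squareFreeCount c n) total) (ℕ→ℚ-* q (squareFreeCount c n))
      X*[Q-1]≡Q*t : X * (Q - 1ℚ) ≡ Q * t (suc (suc n))
      X*[Q-1]≡Q*t = trans (cong₂ _*_ X≡Q*e q-1≡C)
        (trans (solve 3 (λ Q x C → Q :* x :* C := Q :* (C :* x)) refl Q (e n) C)
               (cong (Q *_) (sym (t≡C*e n))))

open import Data.Nat using (ℕ; suc; _+_; _≤_; _^_; _∸_; _*_; s≤s)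
open import Data.Product using (_×_; _,_)
import Data.Integer as ℤ
open import Relation.Binary.PropositionalEquality using (_≡_; refl; sym; trans; cong)
open import Data.Integer.Properties using (pos-+)
import Data.Rational as ℚ

ℕ-sum⇒ℤ-difference : ∀ m k {t} → m + k ≡ t → ℤ.+ m ≡ ℤ.+ t ℤ.- ℤ.+ k
ℕ-sum⇒ℤ-difference m k refl =
  sym (trans (cong (ℤ._- ℤ.+ k) (pos-+ m k))
             (solve 2 (λ x y → (x :+ y) :- y := x) refl (ℤ.+ m) (ℤ.+ k)))
  where
  open import Data.Integer.Solver using (module +-*-Solver)
  open +-*-Solver using (solve; _:+_; _:-_; _:=_)

mainTheorem6 : (q n : ℕ) → 2 ≤ q → 1 ≤ n →
    (ℤ.+ S q n 1 ≡ ℤ.+ (q ^ suc n) ℤ.- ℤ.+ (q * (q ∸ 1) ^ n))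
    × (_⊗_ (Dq q) (emb (ℕ→ℚ (q ^ suc n) ℚ.- ℕ→ℚ (S q n 2)))
                 (_⊗_ (Dq q) (emb (ℕ→ℚ q ℚ.- ℚ.1ℚ)) √D)
       ≡ _⊗_ (Dq q) (emb (ℕ→ℚ q))
                 (_⊖_ (Dq q) (pow (Dq q) (α q) (suc (suc n))) (pow (Dq q) (β q) (suc (suc n)))))
-- S_{n,1} and S_{n,2} from their complementary counts.
mainTheorem6 q@(suc c) n (s≤s _) _ =
  ℕ-sum⇒ℤ-difference (S q n 1) (q * c ^ n) (Counting.S₁-complement q n) ,
  ClosedForm.SquarePalindromes.closed-form c n (S q n 2) (Counting.S₂-complement q n)
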